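{- Let $\epsilon$ be a positive integer and let $H(X,Y)=X^2-9XY+Y^2+3\epsilon X+3\epsilon Y+\epsilon^2$. Let $$H_0=\{(x,y)\in\mathbb{N}^2\mid H(x,y)=0,\ x\equiv y\equiv 0\pmod{\epsilon}\}.$$ Then $$H_0=\Big\{(x,y)\ \Big|\ (x,y,\epsilon)=(\epsilon,\epsilon,\epsilon)\begin{pmatrix}9&1&0\\-1&0&0\\-3&0&1\end{pmatrix}^{n},\ n\in\mathbb{Z}\Big\}.$$
   Context: $\mathbb{N}$ denotes the positive integers; vectors are row vectors multiplied on the right by matrices. -}

module Defs where

open import Data.Nat using (ℕ; zero; suc)
open import Data.Integer using (ℤ; +_; -[1+_]; _+_; _*_; -_; _-_)
open import Data.Vec using (Vec; []; _∷_; lookup; tabulate; foldr; zipWith; map)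
open import Data.Fin using (Fin)
open import Relation.Binary.PropositionalEquality using (_≡_; refl)

-- Matrices over ℤ as vectors of rows.
Matrix : ℕ → Set
Matrix n = Vec (Vec ℤ n) n

sumℤ : ∀ {n} → Vec ℤ n → ℤ
sumℤ = foldr _ _+_ (+ 0)

entry : ∀ {n} → Matrix n → Fin n → Fin n → ℤ
entry A i j = lookup (lookup A i) j

_·ᵥ_ : ∀ {n} → Vec ℤ n → Matrix n → Vec ℤ n
v ·ᵥ A = tabulate λ j → sumℤ (tabulate λ i → lookup v i * entry A i j)

_⊗_ : ∀ {n} → Matrix n → Matrix n → Matrix n
A ⊗ B = tabulate λ i → tabulate λ j → sumℤ (tabulate λ k → entry A i k * entry B k j)

identity : ∀ {n} → Matrix n
identity {zero} = []
identity {suc n} = (+ 1 ∷ tabulate (λ _ → + 0)) ∷ map (+ 0 ∷_) identity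

_^ℕ_ : ∀ {n} → Matrix n → ℕ → Matrix n
A ^ℕ zero = identity
A ^ℕ suc k = A ⊗ (A ^ℕ k)

M : Matrix 3
M = (+ 9 ∷ + 1 ∷ + 0 ∷ [])
  ∷ (- + 1 ∷ + 0 ∷ + 0 ∷ [])
  ∷ (- + 3 ∷ + 0 ∷ + 1 ∷ [])
  ∷ []

Minv : Matrix 3
Minv = (+ 0 ∷ - + 1 ∷ + 0 ∷ [])
     ∷ (+ 1 ∷ + 9 ∷ + 0 ∷ [])
     ∷ (+ 0 ∷ - + 3 ∷ + 1 ∷ [])
     ∷ []

M⊗Minv : M ⊗ Minv ≡ identity
M⊗Minv = refl

Minv⊗M : Minv ⊗ M ≡ identity
Minv⊗M = refl

M^_ : ℤ → Matrix 3
M^ (+ k) = M ^ℕ k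
M^ (-[1+ k ]) = Minv ^ℕ suc k

H : ℤ → ℤ → ℤ → ℤ
H ε x y = x * x - + 9 * x * y + y * y + + 3 * ε * x + + 3 * ε * y + ε * ε

{-# OPTIONS --safe #-}

-- Put x = εa and y = εb. Then H(x, y) = ε²(a² − 9ab + b² + 3a + 3b + 1), and M and M⁻¹ act
-- on (εa, εb, ε) by sending (a, b) to (9a − 3 − b, a) and to (b, 9b − 3 − a): Vieta jumping,
-- since 9a − 3 − b is the second root of the quadratic in b obtained by fixing a. Starting
-- from (1, 1), jumping with M keeps the first coordinate the larger one and jumping with M⁻¹
-- keeps the second one larger, so the orbit consists of positive solutions. Conversely,
-- replacing the larger coordinate of a solution by the other root strictly decreases a + b,
-- since (b + 1, b) is never a solution, until the only diagonal solution (1, 1) is reached;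
-- undoing these jumps puts every solution on the orbit.
module Submission where

open import Defs

module MatrixAction where
  open import Data.Nat using (zero; suc)
  open import Data.Integer using (ℤ; +_; _+_; _*_; 0ℤ)
  open import Data.Integer.Properties
    using (+-*-semiring; *-zeroʳ; *-identityʳ; *-assoc; +-identityʳ; +-identityˡ)
  open import Algebra.Properties.Semiring.Sum +-*-semiring
    using (sum; ∑-comm; *-distribˡ-sum; *-distribʳ-sum; sum-cong-≗)
  open import Data.Fin using (Fin; zero; suc)
  open import Data.Vec using (Vec; []; _∷_; lookup; tabulate)
  open import Data.Vec.Properties using (tabulate-cong; lookup∘tabulate; tabulate∘lookup; lookup-map)
  open import Function using (_∘_)
  open import Relation.Binary.PropositionalEquality
  open ≡-Reasoning

  sumℤ-tabulate : ∀ {n} (f : Fin n → ℤ) → sumℤ (tabulate f) ≡ sum f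
  sumℤ-tabulate {zero} f = refl
  sumℤ-tabulate {suc n} f = cong (λ s → f zero + s) (sumℤ-tabulate (f ∘ suc))

  lookup-·ᵥ : ∀ {n} (v : Vec ℤ n) (A : Matrix n) j →
    lookup (v ·ᵥ A) j ≡ sum (λ i → lookup v i * entry A i j)
  lookup-·ᵥ v A j = trans (lookup∘tabulate _ j) (sumℤ-tabulate (λ i → lookup v i * entry A i j))

  entry-⊗ : ∀ {n} (A B : Matrix n) i k → entry (A ⊗ B) i k ≡ sum (λ j → entry A i j * entry B j k)
  entry-⊗ A B i k = begin
    lookup (lookup (A ⊗ B) i) k                      ≡⟨ cong (λ r → lookup r k) (lookup∘tabulate _ i) ⟩
    lookup (tabulate _) k                            ≡⟨ lookup∘tabulate _ k ⟩
    sumℤ (tabulate λ j → entry A i j * entry B j k)  ≡⟨ sumℤ-tabulate (λ j → entry A i j * entry B j k) ⟩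
    sum (λ j → entry A i j * entry B j k)            ∎

  ·ᵥ-⊗ : ∀ {n} (v : Vec ℤ n) (A B : Matrix n) → v ·ᵥ (A ⊗ B) ≡ (v ·ᵥ A) ·ᵥ B
  ·ᵥ-⊗ v A B = tabulate-cong λ k → begin
    sumℤ (tabulate λ i → lookup v i * entry (A ⊗ B) i k)
      ≡⟨ sumℤ-tabulate (λ i → lookup v i * entry (A ⊗ B) i k) ⟩
    sum (λ i → lookup v i * entry (A ⊗ B) i k)
      ≡⟨ sum-cong-≗ (λ i → cong (lookup v i *_) (entry-⊗ A B i k)) ⟩
    sum (λ i → lookup v i * sum (λ j → entry A i j * entry B j k))
      ≡⟨ sum-cong-≗ (λ i → *-distribˡ-sum (lookup v i) (λ j → entry A i j * entry B j k)) ⟩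
    sum (λ i → sum (λ j → lookup v i * (entry A i j * entry B j k)))
      ≡⟨ ∑-comm (λ i j → lookup v i * (entry A i j * entry B j k)) ⟩
    sum (λ j → sum (λ i → lookup v i * (entry A i j * entry B j k)))
      ≡⟨ sum-cong-≗ (λ j → sum-cong-≗ λ i → sym (*-assoc (lookup v i) (entry A i j) (entry B j k))) ⟩
    sum (λ j → sum (λ i → lookup v i * entry A i j * entry B j k))
      ≡⟨ sum-cong-≗ (λ j → sym (*-distribʳ-sum (entry B j k) (λ i → lookup v i * entry A i j))) ⟩
    sum (λ j → sum (λ i → lookup v i * entry A i j) * entry B j k)
      ≡⟨ sum-cong-≗ (λ j → cong (_* entry B j k) (sym (lookup-·ᵥ v A j))) ⟩
    sum (λ j → lookup (v ·ᵥ A) j * entry B j k)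
      ≡⟨ sumℤ-tabulate (λ j → lookup (v ·ᵥ A) j * entry B j k) ⟨
    sumℤ (tabulate λ j → lookup (v ·ᵥ A) j * entry B j k) ∎

  entry-identity-zero-suc : ∀ {n} (j : Fin n) → entry identity zero (suc j) ≡ 0ℤ
  entry-identity-zero-suc j = lookup∘tabulate _ j

  entry-identity-suc : ∀ {n} (i : Fin n) j → entry identity (suc i) j ≡ lookup (+ 0 ∷ lookup identity i) j
  entry-identity-suc i j = cong (λ r → lookup r j) (lookup-map i (+ 0 ∷_) identity)

  sum-*-zero : ∀ {n} (f : Fin n → ℤ) → sum (λ i → f i * 0ℤ) ≡ 0ℤ
  sum-*-zero f = trans (sym (*-distribʳ-sum 0ℤ f)) (*-zeroʳ (sum f))

  sum-*-identity : ∀ {n} (f : Fin n → ℤ) j → sum (λ i → f i * entry identity i j) ≡ f j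
  sum-*-identity f zero = begin
    f zero * + 1 + sum (λ i → f (suc i) * entry identity (suc i) zero)
      ≡⟨ cong₂ _+_ (*-identityʳ (f zero))
           (sum-cong-≗ λ i → cong (f (suc i) *_) (entry-identity-suc i zero)) ⟩
    f zero + sum (λ i → f (suc i) * 0ℤ)
      ≡⟨ cong (λ s → f zero + s) (sum-*-zero (f ∘ suc)) ⟩
    f zero + 0ℤ
      ≡⟨ +-identityʳ (f zero) ⟩
    f zero ∎
  sum-*-identity f (suc j) = begin
    f zero * entry identity zero (suc j) + sum (λ i → f (suc i) * entry identity (suc i) (suc j))
      ≡⟨ cong₂ _+_ (trans (cong (f zero *_) (entry-identity-zero-suc j)) (*-zeroʳ (f zero)))
           (sum-cong-≗ λ i → cong (f (suc i) *_) (entry-identity-suc i (suc j))) ⟩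
    0ℤ + sum (λ i → f (suc i) * entry identity i j)
      ≡⟨ +-identityˡ _ ⟩
    sum (λ i → f (suc i) * entry identity i j)
      ≡⟨ sum-*-identity (f ∘ suc) j ⟩
    f (suc j) ∎

  ·ᵥ-identity : ∀ {n} (v : Vec ℤ n) → v ·ᵥ identity ≡ v
  ·ᵥ-identity v = trans
    (tabulate-cong λ j → trans (sumℤ-tabulate (λ i → lookup v i * entry identity i j)) (sum-*-identity (lookup v) j))
    (tabulate∘lookup v)

  ·ᵥ-cancel : ∀ {n} (A B : Matrix n) → A ⊗ B ≡ identity → ∀ v → (v ·ᵥ A) ·ᵥ B ≡ v
  ·ᵥ-cancel A B AB≡I v = begin
    (v ·ᵥ A) ·ᵥ B   ≡⟨ ·ᵥ-⊗ v A B ⟨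
    v ·ᵥ (A ⊗ B)    ≡⟨ cong (v ·ᵥ_) AB≡I ⟩
    v ·ᵥ identity   ≡⟨ ·ᵥ-identity v ⟩
    v               ∎

  ·ᵥ-^ℕ-suc : ∀ {n} (A : Matrix n) (v : Vec ℤ n) k → v ·ᵥ (A ^ℕ suc k) ≡ (v ·ᵥ (A ^ℕ k)) ·ᵥ A
  ·ᵥ-^ℕ-suc A v zero = begin
    v ·ᵥ (A ⊗ identity)       ≡⟨ ·ᵥ-⊗ v A identity ⟩
    (v ·ᵥ A) ·ᵥ identity      ≡⟨ ·ᵥ-identity (v ·ᵥ A) ⟩
    v ·ᵥ A                    ≡⟨ cong (_·ᵥ A) (·ᵥ-identity v) ⟨
    (v ·ᵥ identity) ·ᵥ A      ∎
  ·ᵥ-^ℕ-suc A v (suc k) = begin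
    v ·ᵥ (A ⊗ (A ^ℕ suc k))         ≡⟨ ·ᵥ-⊗ v A (A ^ℕ suc k) ⟩
    (v ·ᵥ A) ·ᵥ (A ^ℕ suc k)        ≡⟨ ·ᵥ-^ℕ-suc A (v ·ᵥ A) k ⟩
    ((v ·ᵥ A) ·ᵥ (A ^ℕ k)) ·ᵥ A     ≡⟨ cong (_·ᵥ A) (·ᵥ-⊗ v A (A ^ℕ k)) ⟨
    (v ·ᵥ (A ⊗ (A ^ℕ k))) ·ᵥ A      ∎

  ·ᵥ-^ℕ-suc-·ᵥ-inverse : ∀ {n} (A B : Matrix n) → A ⊗ B ≡ identity →
    ∀ v k → (v ·ᵥ (A ^ℕ suc k)) ·ᵥ B ≡ v ·ᵥ (A ^ℕ k)
  ·ᵥ-^ℕ-suc-·ᵥ-inverse A B AB≡I v k =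
    trans (cong (_·ᵥ B) (·ᵥ-^ℕ-suc A v k)) (·ᵥ-cancel A B AB≡I (v ·ᵥ (A ^ℕ k)))

open MatrixAction

module Curve where
  open import Data.Nat
  open import Data.Nat.Properties
  open import Data.Nat.Tactic.RingSolver using (solve-∀)
  open import Data.Empty using (⊥-elim)
  open import Relation.Nullary using (¬_)
  open import Relation.Binary.PropositionalEquality

  -- H(1, a, b) = 0, with 9ab moved to the right-hand side so that it is an equation in ℕ.
  record OnCurve (a b : ℕ) : Set where
    constructor onCurve
    field equation : a * a + b * b + 3 * a + 3 * b + 1 ≡ 9 * a * b

  OnCurve-sym : ∀ {a b} → OnCurve a b → OnCurve b a
  OnCurve-sym {a} {b} (onCurve h) = onCurve (begin
    b * b + a * a + 3 * b + 3 * a + 1 ≡⟨ swap a b ⟩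
    a * a + b * b + 3 * a + 3 * b + 1 ≡⟨ h ⟩
    9 * a * b                         ≡⟨ *-comm-9 a b ⟩
    9 * b * a                         ∎)
    where
    open ≡-Reasoning
    swap : ∀ a b → b * b + a * a + 3 * b + 3 * a + 1 ≡ a * a + b * b + 3 * a + 3 * b + 1
    swap = solve-∀
    *-comm-9 : ∀ a b → 9 * a * b ≡ 9 * b * a
    *-comm-9 = solve-∀

  OnCurve⇒1≤ : ∀ {a b} → OnCurve a b → 1 ≤ a
  OnCurve⇒1≤ {zero} {b} (onCurve h) = ⊥-elim (1+n≢0 (trans (+-comm 1 _) h))
  OnCurve⇒1≤ {suc a} h = s≤s z≤n

  OnCurve-diagonal : ∀ {a} → OnCurve a a → a ≡ 1
  OnCurve-diagonal {zero} (onCurve ())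
  OnCurve-diagonal {suc zero} h = refl
  OnCurve-diagonal {suc (suc c)} (onCurve h) = ⊥-elim (m≢1+m+n _ (trans h (excess c)))
    where
    excess : ∀ c → 9 * suc (suc c) * suc (suc c) ≡
      suc (suc (suc c) * suc (suc c) + suc (suc c) * suc (suc c) + 3 * suc (suc c) + 3 * suc (suc c) + 1
           + (7 * c * c + 22 * c + 14))
    excess = solve-∀

  ¬OnCurve-suc : ∀ b → ¬ OnCurve (suc b) b
  ¬OnCurve-suc zero (onCurve ())
  ¬OnCurve-suc (suc c) (onCurve h) = m≢1+m+n _ (trans h (excess c))
    where
    excess : ∀ c → 9 * suc (suc c) * suc c ≡
      suc (suc (suc c) * suc (suc c) + suc c * suc c + 3 * suc (suc c) + 3 * suc c + 1
           + (7 * c * c + 15 * c + 2))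
    excess = solve-∀

  module _ {a b r : ℕ} (h : OnCurve a b) (root : r + (a + 3) ≡ 9 * b) where

    vieta-product : a * r ≡ b * b + 3 * b + 1
    vieta-product = +-cancelʳ-≡ (a * a + 3 * a) (a * r) (b * b + 3 * b + 1) (begin
      a * r + (a * a + 3 * a)               ≡⟨ expand a r ⟨
      a * (r + (a + 3))                     ≡⟨ cong (a *_) root ⟩
      a * (9 * b)                           ≡⟨ *-assoc-9 a b ⟩
      9 * a * b                             ≡⟨ OnCurve.equation h ⟨
      a * a + b * b + 3 * a + 3 * b + 1     ≡⟨ regroup a b ⟩
      b * b + 3 * b + 1 + (a * a + 3 * a)   ∎)
      where
      open ≡-Reasoning
      expand : ∀ a r → a * (r + (a + 3)) ≡ a * r + (a * a + 3 * a)
      expand = solve-∀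
      *-assoc-9 : ∀ a b → a * (9 * b) ≡ 9 * a * b
      *-assoc-9 = solve-∀
      regroup : ∀ a b → a * a + b * b + 3 * a + 3 * b + 1 ≡ b * b + 3 * b + 1 + (a * a + 3 * a)
      regroup = solve-∀

    vieta : OnCurve r b
    vieta = onCurve (begin
      r * r + b * b + 3 * r + 3 * b + 1   ≡⟨ regroup r b ⟩
      r * r + 3 * r + (b * b + 3 * b + 1) ≡⟨ cong (λ s → r * r + 3 * r + s) vieta-product ⟨
      r * r + 3 * r + a * r               ≡⟨ factor r a ⟩
      r * (r + (a + 3))                   ≡⟨ cong (r *_) root ⟩
      r * (9 * b)                         ≡⟨ *-assoc-9 r b ⟩
      9 * r * b                           ∎)
      where
      open ≡-Reasoning
      regroup : ∀ r b → r * r + b * b + 3 * r + 3 * b + 1 ≡ r * r + 3 * r + (b * b + 3 * b + 1)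
      regroup = solve-∀
      factor : ∀ r a → r * r + 3 * r + a * r ≡ r * (r + (a + 3))
      factor = solve-∀
      *-assoc-9 : ∀ r b → r * (9 * b) ≡ 9 * r * b
      *-assoc-9 = solve-∀

  OnCurve⇒a+3<9b : ∀ {a b} → OnCurve a b → a + 3 < 9 * b
  OnCurve⇒a+3<9b {a} {b} h = *-cancelˡ-< a (a + 3) (9 * b) (begin-strict
    a * (a + 3)                                 <⟨ m<m+n (a * (a + 3)) z<s ⟩
    a * (a + 3) + suc (b * b + 3 * b)           ≡⟨ regroup a b ⟩
    a * a + b * b + 3 * a + 3 * b + 1           ≡⟨ OnCurve.equation h ⟩
    9 * a * b                                   ≡⟨ *-assoc-9 a b ⟩
    a * (9 * b)                                 ∎)
    where
    open ≤-Reasoning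
    regroup : ∀ a b → a * (a + 3) + suc (b * b + 3 * b) ≡ a * a + b * b + 3 * a + 3 * b + 1
    regroup = solve-∀
    *-assoc-9 : ∀ a b → 9 * a * b ≡ a * (9 * b)
    *-assoc-9 = solve-∀

  -- On the curve the truncated subtraction is exact (otherRoot-sum), and a and otherRoot a b
  -- are the two roots of X² − (9b − 3)X + b² + 3b + 1.
  otherRoot : ℕ → ℕ → ℕ
  otherRoot a b = 9 * b ∸ (a + 3)

  otherRoot-sum : ∀ {a b} → OnCurve a b → otherRoot a b + (a + 3) ≡ 9 * b
  otherRoot-sum h = m∸n+n≡m (<⇒≤ (OnCurve⇒a+3<9b h))

  OnCurve-otherRoot : ∀ {a b} → OnCurve a b → OnCurve (otherRoot a b) b
  OnCurve-otherRoot h = vieta h (otherRoot-sum h)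

  otherRoot-< : ∀ {a b} → OnCurve a b → b < a → otherRoot a b < a
  otherRoot-< {a} {b} h b<a = *-cancelˡ-< a (otherRoot a b) a (begin-strict
    a * otherRoot a b              ≡⟨ vieta-product h (otherRoot-sum h) ⟩
    b * b + 3 * b + 1              <⟨ m<m+n (b * b + 3 * b + 1) z<s ⟩
    b * b + 3 * b + 1 + (3 + b)    ≡⟨ square b ⟩
    (2 + b) * (2 + b)              ≤⟨ *-mono-≤ 2+b≤a 2+b≤a ⟩
    a * a                          ∎)
    where
    open ≤-Reasoning
    square : ∀ b → b * b + 3 * b + 1 + (3 + b) ≡ (2 + b) * (2 + b)
    square = solve-∀
    2+b≤a : 2 + b ≤ a
    2+b≤a = ≤∧≢⇒< b<a λ { refl → ¬OnCurve-suc b h }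

  otherRoot-≥ : ∀ {a b} → OnCurve a b → a ≤ b → b ≤ otherRoot a b
  otherRoot-≥ {a} {b} h a≤b = +-cancelʳ-≤ (a + 3) b (otherRoot a b) (begin
    b + (a + 3)             ≤⟨ +-monoʳ-≤ b (+-mono-≤ a≤b 3≤7b) ⟩
    b + (b + 7 * b)         ≡⟨ collect b ⟩
    9 * b                   ≡⟨ otherRoot-sum h ⟨
    otherRoot a b + (a + 3) ∎)
    where
    open ≤-Reasoning
    3≤7b : 3 ≤ 7 * b
    3≤7b = ≤-trans (s≤s (s≤s (s≤s z≤n))) (*-monoʳ-≤ 7 (OnCurve⇒1≤ (OnCurve-sym h)))
    collect : ∀ b → b + (b + 7 * b) ≡ 9 * b
    collect = solve-∀

open Curve

open import Data.Nat using (ℕ; zero; suc)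
import Data.Nat as ℕ
import Data.Nat.Properties as ℕₚ
open import Data.Nat.Divisibility using (divides; m∣m*n)
open import Data.Nat.Induction using (<-wellFounded)
open import Data.Integer using (ℤ; +_; -[1+_]; _+_; _*_; -_; _-_; _<_; +<+; 0ℤ)
import Data.Integer as ℤ
open import Data.Integer.Properties
  using (*-zeroʳ; *-identityʳ; pos-+; pos-*; i*j≡0⇒i≡0∨j≡0; i≡j⇒i-j≡0; i-j≡0⇒i≡j; +-injective)
open import Data.Integer.Divisibility using (_∣_)
open import Data.Integer.Tactic.RingSolver using (solve-∀)
open import Data.Vec using (Vec; []; _∷_)
open import Data.Product using (_×_; _,_; ∃-syntax)
open import Data.Sum using (inj₂)
open import Function.Bundles using (_⇔_; mk⇔)
open import Induction.WellFounded using (Acc; acc)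
open import Relation.Binary.Definitions using (tri<; tri≈; tri>)
open import Relation.Binary.PropositionalEquality
open ≡-Reasoning

·ᵥ-M^-suc : ∀ v n → v ·ᵥ (M^ ℤ.suc n) ≡ (v ·ᵥ (M^ n)) ·ᵥ M
·ᵥ-M^-suc v (+ k) = ·ᵥ-^ℕ-suc M v k
·ᵥ-M^-suc v -[1+ zero ] = sym (·ᵥ-^ℕ-suc-·ᵥ-inverse Minv M Minv⊗M v zero)
·ᵥ-M^-suc v -[1+ suc k ] = sym (·ᵥ-^ℕ-suc-·ᵥ-inverse Minv M Minv⊗M v (suc k))

·ᵥ-M^-pred : ∀ v n → v ·ᵥ (M^ ℤ.pred n) ≡ (v ·ᵥ (M^ n)) ·ᵥ Minv
·ᵥ-M^-pred v (+ zero) = ·ᵥ-^ℕ-suc Minv v zero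
·ᵥ-M^-pred v (+ suc k) = sym (·ᵥ-^ℕ-suc-·ᵥ-inverse M Minv M⊗Minv v k)
·ᵥ-M^-pred v -[1+ k ] = ·ᵥ-^ℕ-suc Minv v (suc k)

·ᵥ-M : ∀ x y z → (x ∷ y ∷ z ∷ []) ·ᵥ M ≡ (+ 9 * x - y - + 3 * z) ∷ x ∷ z ∷ []
·ᵥ-M x y z = cong₂ _∷_ (new x y z) (cong₂ _∷_ (kept₁ x y z) (cong (_∷ []) (kept₃ x y z)))
  where
  new : ∀ x y z → x * + 9 + (y * - + 1 + (z * - + 3 + + 0)) ≡ + 9 * x - y - + 3 * z
  new = solve-∀
  kept₁ : ∀ x y z → x * + 1 + (y * + 0 + (z * + 0 + + 0)) ≡ x
  kept₁ = solve-∀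
  kept₃ : ∀ x y z → x * + 0 + (y * + 0 + (z * + 1 + + 0)) ≡ z
  kept₃ = solve-∀

·ᵥ-Minv : ∀ x y z → (x ∷ y ∷ z ∷ []) ·ᵥ Minv ≡ y ∷ (+ 9 * y - x - + 3 * z) ∷ z ∷ []
·ᵥ-Minv x y z = cong₂ _∷_ (kept₂ x y z) (cong₂ _∷_ (new x y z) (cong (_∷ []) (kept₃ x y z)))
  where
  kept₂ : ∀ x y z → x * + 0 + (y * + 1 + (z * + 0 + + 0)) ≡ y
  kept₂ = solve-∀
  new : ∀ x y z → x * - + 1 + (y * + 9 + (z * - + 3 + + 0)) ≡ + 9 * y - x - + 3 * z
  new = solve-∀
  kept₃ : ∀ x y z → x * + 0 + (y * + 0 + (z * + 1 + + 0)) ≡ z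
  kept₃ = solve-∀

scaled : ℕ → ℕ → ℕ → Vec ℤ 3
scaled ε a b = + ε * + a ∷ + ε * + b ∷ + ε ∷ []

scaled-otherRoot : ∀ ε {a b r} → r ℕ.+ (b ℕ.+ 3) ≡ 9 ℕ.* a →
  + 9 * (+ ε * + a) - + ε * + b - + 3 * + ε ≡ + ε * + r
scaled-otherRoot ε {a} {b} {r} root = begin
  + 9 * (+ ε * + a) - + ε * + b - + 3 * + ε      ≡⟨ expand (+ ε) (+ a) (+ b) ⟩
  + ε * (+ 9 * + a) - + ε * (+ b + + 3)          ≡⟨ cong (λ s → + ε * s - + ε * (+ b + + 3)) rootℤ ⟨
  + ε * (+ r + (+ b + + 3)) - + ε * (+ b + + 3)  ≡⟨ cancel (+ ε) (+ b) (+ r) ⟩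
  + ε * + r                                      ∎
  where
  rootℤ : + r + (+ b + + 3) ≡ + 9 * + a
  rootℤ = begin
    + r + (+ b + + 3)   ≡⟨ cong (λ s → + r + s) (pos-+ b 3) ⟨
    + r + + (b ℕ.+ 3)   ≡⟨ pos-+ r (b ℕ.+ 3) ⟨
    + (r ℕ.+ (b ℕ.+ 3)) ≡⟨ cong +_ root ⟩
    + (9 ℕ.* a)         ≡⟨ pos-* 9 a ⟩
    + 9 * + a           ∎
  expand : ∀ e a b → + 9 * (e * a) - e * b - + 3 * e ≡ e * (+ 9 * a) - e * (b + + 3)
  expand = solve-∀
  cancel : ∀ e b r → e * (r + (b + + 3)) - e * (b + + 3) ≡ e * r
  cancel = solve-∀

scaled-·ᵥ-M : ∀ ε {a b r} → r ℕ.+ (b ℕ.+ 3) ≡ 9 ℕ.* a → scaled ε a b ·ᵥ M ≡ scaled ε r a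
scaled-·ᵥ-M ε root = trans (·ᵥ-M _ _ _) (cong (_∷ _) (scaled-otherRoot ε root))

scaled-·ᵥ-Minv : ∀ ε {a b r} → r ℕ.+ (a ℕ.+ 3) ≡ 9 ℕ.* b → scaled ε a b ·ᵥ Minv ≡ scaled ε b r
scaled-·ᵥ-Minv ε root = trans (·ᵥ-Minv _ _ _) (cong (λ s → _ ∷ s ∷ _) (scaled-otherRoot ε root))

H-scaled : ∀ ε a b → H (+ ε) (+ ε * + a) (+ ε * + b) ≡
  + ε * + ε * (+ (a ℕ.* a ℕ.+ b ℕ.* b ℕ.+ 3 ℕ.* a ℕ.+ 3 ℕ.* b ℕ.+ 1) - + (9 ℕ.* a ℕ.* b))
H-scaled ε a b = begin
  H (+ ε) (+ ε * + a) (+ ε * + b)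
    ≡⟨ homogeneous (+ ε) (+ a) (+ b) ⟩
  + ε * + ε * ((+ a * + a + + b * + b + + 3 * + a + + 3 * + b + + 1) - + 9 * + a * + b)
    ≡⟨ cong₂ (λ s t → + ε * + ε * (s - t)) pos-lhs pos-rhs ⟨
  + ε * + ε * (+ (a ℕ.* a ℕ.+ b ℕ.* b ℕ.+ 3 ℕ.* a ℕ.+ 3 ℕ.* b ℕ.+ 1) - + (9 ℕ.* a ℕ.* b)) ∎
  where
  homogeneous : ∀ e x y →
    (e * x) * (e * x) - + 9 * (e * x) * (e * y) + (e * y) * (e * y) + + 3 * e * (e * x) + + 3 * e * (e * y) + e * e ≡ e * e * ((x * x + y * y + + 3 * x + + 3 * y + + 1) - + 9 * x * y)
  homogeneous = solve-∀
  pos-lhs : + (a ℕ.* a ℕ.+ b ℕ.* b ℕ.+ 3 ℕ.* a ℕ.+ 3 ℕ.* b ℕ.+ 1) ≡ + a * + a + + b * + b + + 3 * + a + + 3 * + b + + 1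
  pos-lhs = begin
    + (a ℕ.* a ℕ.+ b ℕ.* b ℕ.+ 3 ℕ.* a ℕ.+ 3 ℕ.* b ℕ.+ 1)
      ≡⟨ pos-+ (a ℕ.* a ℕ.+ b ℕ.* b ℕ.+ 3 ℕ.* a ℕ.+ 3 ℕ.* b) 1 ⟩
    + (a ℕ.* a ℕ.+ b ℕ.* b ℕ.+ 3 ℕ.* a ℕ.+ 3 ℕ.* b) + + 1
      ≡⟨ cong (_+ + 1) (pos-+ (a ℕ.* a ℕ.+ b ℕ.* b ℕ.+ 3 ℕ.* a) (3 ℕ.* b)) ⟩
    + (a ℕ.* a ℕ.+ b ℕ.* b ℕ.+ 3 ℕ.* a) + + (3 ℕ.* b) + + 1
      ≡⟨ cong (λ s → s + + (3 ℕ.* b) + + 1) (pos-+ (a ℕ.* a ℕ.+ b ℕ.* b) (3 ℕ.* a)) ⟩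
    + (a ℕ.* a ℕ.+ b ℕ.* b) + + (3 ℕ.* a) + + (3 ℕ.* b) + + 1
      ≡⟨ cong (λ s → s + + (3 ℕ.* a) + + (3 ℕ.* b) + + 1) (pos-+ (a ℕ.* a) (b ℕ.* b)) ⟩
    + (a ℕ.* a) + + (b ℕ.* b) + + (3 ℕ.* a) + + (3 ℕ.* b) + + 1
      ≡⟨ cong₂ (λ s t → s + t + + 1) (cong₂ (λ s t → s + t) (cong₂ _+_ (pos-* a a) (pos-* b b)) (pos-* 3 a)) (pos-* 3 b) ⟩
    + a * + a + + b * + b + + 3 * + a + + 3 * + b + + 1 ∎
  pos-rhs : + (9 ℕ.* a ℕ.* b) ≡ + 9 * + a * + b
  pos-rhs = trans (pos-* (9 ℕ.* a) b) (cong (_* + b) (pos-* 9 a))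

OnCurve⇒H≡0 : ∀ ε {a b} → OnCurve a b → H (+ ε) (+ ε * + a) (+ ε * + b) ≡ 0ℤ
OnCurve⇒H≡0 ε {a} {b} (onCurve eq) = begin
  H (+ ε) (+ ε * + a) (+ ε * + b)       ≡⟨ H-scaled ε a b ⟩
  + ε * + ε * (+ _ - + (9 ℕ.* a ℕ.* b))  ≡⟨ cong (+ ε * + ε *_) (i≡j⇒i-j≡0 (cong +_ eq)) ⟩
  + ε * + ε * 0ℤ                         ≡⟨ *-zeroʳ (+ ε * + ε) ⟩
  0ℤ                                     ∎

H≡0⇒OnCurve : ∀ {ε a b} → 0 ℕ.< ε → H (+ ε) (+ ε * + a) (+ ε * + b) ≡ 0ℤ → OnCurve a b
H≡0⇒OnCurve {suc k} {a} {b} _ H≡0 with i*j≡0⇒i≡0∨j≡0 (+ suc k * + suc k) (trans (sym (H-scaled (suc k) a b)) H≡0)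
... | inj₂ difference≡0 = onCurve (+-injective (i-j≡0⇒i≡j _ _ difference≡0))

InH₀ : ℕ → ℤ → ℤ → Set
InH₀ ε x y = (+ 0 < x × + 0 < y) × H (+ ε) x y ≡ + 0 × (+ ε ∣ x × + ε ∣ y)

positive-multiple : ∀ {ε x} → + 0 < x → + ε ∣ x → ∃[ a ] x ≡ + ε * + a
positive-multiple {ε} {+ n} _ (divides a n≡a*ε) = a , (begin
  + n          ≡⟨ cong +_ (trans n≡a*ε (ℕₚ.*-comm a ε)) ⟩
  + (ε ℕ.* a)  ≡⟨ pos-* ε a ⟩
  + ε * + a    ∎)

scaled-positive : ∀ {ε a} → 0 ℕ.< ε → 1 ℕ.≤ a → + 0 < + ε * + a
scaled-positive {ε} {a} 0<ε 1≤a = subst (+ 0 <_) (pos-* ε a) (+<+ (ℕₚ.*-mono-≤ 0<ε 1≤a))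

∣-scaled : ∀ ε a → + ε ∣ + ε * + a
∣-scaled ε a = subst (+ ε ∣_) (pos-* ε a) (m∣m*n a)

OnCurve⇒InH₀ : ∀ {ε a b} → 0 ℕ.< ε → OnCurve a b → InH₀ ε (+ ε * + a) (+ ε * + b)
OnCurve⇒InH₀ {ε} {a} {b} 0<ε h =
  (scaled-positive 0<ε (OnCurve⇒1≤ h) , scaled-positive 0<ε (OnCurve⇒1≤ (OnCurve-sym h))) ,
  OnCurve⇒H≡0 ε h ,
  (∣-scaled ε a , ∣-scaled ε b)

start : ℕ → Vec ℤ 3
start ε = + ε ∷ + ε ∷ + ε ∷ []

Orbit : ℕ → Vec ℤ 3 → Set
Orbit ε w = ∃[ n ] start ε ·ᵥ (M^ n) ≡ w

module _ {ε : ℕ} where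

  start·ᵥidentity : start ε ·ᵥ identity ≡ scaled ε 1 1
  start·ᵥidentity = trans (·ᵥ-identity (start ε)) (cong (λ z → z ∷ z ∷ + ε ∷ []) (sym (*-identityʳ (+ ε))))

  Orbit-·ᵥ-M : ∀ {w} → Orbit ε w → Orbit ε (w ·ᵥ M)
  Orbit-·ᵥ-M (n , eq) = ℤ.suc n , trans (·ᵥ-M^-suc (start ε) n) (cong (_·ᵥ M) eq)

  Orbit-·ᵥ-Minv : ∀ {w} → Orbit ε w → Orbit ε (w ·ᵥ Minv)
  Orbit-·ᵥ-Minv (n , eq) = ℤ.pred n , trans (·ᵥ-M^-pred (start ε) n) (cong (_·ᵥ Minv) eq)

  Orbit-·ᵥ-M⁻¹ : ∀ {w} → Orbit ε (w ·ᵥ M) → Orbit ε w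
  Orbit-·ᵥ-M⁻¹ {w} o = subst (Orbit ε) (·ᵥ-cancel M Minv M⊗Minv w) (Orbit-·ᵥ-Minv o)

  Orbit-·ᵥ-Minv⁻¹ : ∀ {w} → Orbit ε (w ·ᵥ Minv) → Orbit ε w
  Orbit-·ᵥ-Minv⁻¹ {w} o = subst (Orbit ε) (·ᵥ-cancel Minv M Minv⊗M w) (Orbit-·ᵥ-M o)

  OnCurve⇒Orbit : ∀ {a b} → Acc ℕ._<_ (a ℕ.+ b) → OnCurve a b → Orbit ε (scaled ε a b)
  OnCurve⇒Orbit {a} {b} (acc rec) h with ℕₚ.<-cmp a b
  ... | tri≈ _ refl _ rewrite OnCurve-diagonal h = + 0 , start·ᵥidentity
  ... | tri< a<b _ _ = Orbit-·ᵥ-M⁻¹ (subst (Orbit ε) (sym (scaled-·ᵥ-M ε (otherRoot-sum h′)))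
          (OnCurve⇒Orbit (rec smaller) (OnCurve-otherRoot h′)))
    where
    h′ = OnCurve-sym h
    smaller : otherRoot b a ℕ.+ a ℕ.< a ℕ.+ b
    smaller = subst (otherRoot b a ℕ.+ a ℕ.<_) (ℕₚ.+-comm b a) (ℕₚ.+-monoˡ-< a (otherRoot-< h′ a<b))
  ... | tri> _ _ b<a = Orbit-·ᵥ-Minv⁻¹ (subst (Orbit ε) (sym (scaled-·ᵥ-Minv ε (otherRoot-sum h)))
          (OnCurve⇒Orbit (rec smaller) (OnCurve-sym (OnCurve-otherRoot h))))
    where
    smaller : b ℕ.+ otherRoot a b ℕ.< a ℕ.+ b
    smaller = subst (b ℕ.+ otherRoot a b ℕ.<_) (ℕₚ.+-comm b a) (ℕₚ.+-monoʳ-< b (otherRoot-< h b<a))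

  ScaledSolution : (ℕ → ℕ → Set) → Vec ℤ 3 → Set
  ScaledSolution _R_ w = ∃[ a ] ∃[ b ] a R b × OnCurve a b × w ≡ scaled ε a b

  ScaledSolution-·ᵥ-M : ∀ {w} → ScaledSolution ℕ._≥_ w → ScaledSolution ℕ._≥_ (w ·ᵥ M)
  ScaledSolution-·ᵥ-M (a , b , b≤a , h , refl) =
    otherRoot b a , a , otherRoot-≥ h′ b≤a , OnCurve-otherRoot h′ , scaled-·ᵥ-M ε (otherRoot-sum h′)
    where h′ = OnCurve-sym h

  ScaledSolution-·ᵥ-Minv : ∀ {w} → ScaledSolution ℕ._≤_ w → ScaledSolution ℕ._≤_ (w ·ᵥ Minv)
  ScaledSolution-·ᵥ-Minv (a , b , a≤b , h , refl) =
    b , otherRoot a b , otherRoot-≥ h a≤b , OnCurve-sym (OnCurve-otherRoot h) , scaled-·ᵥ-Minv ε (otherRoot-sum h)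

  ScaledSolution-^ℕ : ∀ {_R_} (A : Matrix 3) → (∀ {w} → ScaledSolution _R_ w → ScaledSolution _R_ (w ·ᵥ A)) →
    1 R 1 → ∀ k → ScaledSolution _R_ (start ε ·ᵥ (A ^ℕ k))
  ScaledSolution-^ℕ A step 1R1 zero = 1 , 1 , 1R1 , onCurve refl , start·ᵥidentity
  ScaledSolution-^ℕ {_R_} A step 1R1 (suc k) =
    subst (ScaledSolution _R_) (sym (·ᵥ-^ℕ-suc A (start ε) k)) (step (ScaledSolution-^ℕ A step 1R1 k))

  Orbit⇒OnCurve : ∀ {w} → Orbit ε w → ∃[ a ] ∃[ b ] OnCurve a b × w ≡ scaled ε a b
  Orbit⇒OnCurve (+ k , eq) =
    let a , b , _ , h , eq′ = ScaledSolution-^ℕ M ScaledSolution-·ᵥ-M ℕₚ.≤-refl k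
    in a , b , h , trans (sym eq) eq′
  Orbit⇒OnCurve (-[1+ k ] , eq) =
    let a , b , _ , h , eq′ = ScaledSolution-^ℕ Minv ScaledSolution-·ᵥ-Minv ℕₚ.≤-refl (suc k)
    in a , b , h , trans (sym eq) eq′

InH₀⇒Orbit : ∀ {ε x y} → 0 ℕ.< ε → InH₀ ε x y → Orbit ε (x ∷ y ∷ + ε ∷ [])
InH₀⇒Orbit 0<ε ((0<x , 0<y) , H≡0 , (ε∣x , ε∣y))
  with positive-multiple 0<x ε∣x | positive-multiple 0<y ε∣y
... | a , refl | b , refl = OnCurve⇒Orbit (<-wellFounded (a ℕ.+ b)) (H≡0⇒OnCurve 0<ε H≡0)

Orbit⇒InH₀ : ∀ {ε x y} → 0 ℕ.< ε → Orbit ε (x ∷ y ∷ + ε ∷ []) → InH₀ ε x y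
Orbit⇒InH₀ {ε} 0<ε orbit with Orbit⇒OnCurve {ε} orbit
... | a , b , h , refl = OnCurve⇒InH₀ 0<ε h

lemma4p3 : (ε : ℕ) → 0 Data.Nat.< ε → (x y : ℤ) →
    ((+ 0 < x × + 0 < y) × H (+ ε) x y ≡ + 0 × (+ ε ∣ x × + ε ∣ y))
      ⇔ (∃[ n ] ((+ ε ∷ + ε ∷ + ε ∷ []) ·ᵥ (M^ n) ≡ x ∷ y ∷ + ε ∷ []))
lemma4p3 ε 0<ε x y = mk⇔ (InH₀⇒Orbit 0<ε) (Orbit⇒InH₀ 0<ε)
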